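{- For $n\ge1$ let $R_n(t)=\sum_{\pi\in\mathrm{RSP}(n)}t^{\mathrm{des}(\pi)+1}$. Then $R_1(t)=R_2(t)=t$ and for all $n\ge3$, \[ R_n(t)=tR_{n-1}'(t)+t(n-2)R_{n-2}(t), \] where $'$ denotes the derivative with respect to $t$.
   Context: For $\pi\in S_n$ in one-line notation, $\mathrm{des}(\pi)$ is the number of $k\in[n-1]$ with $\pi(k)>\pi(k+1)$. The runs of $\pi$ are its maximal increasing contiguous subwords; $\mathrm{runsort}(\pi)$ is obtained by rearranging the runs of $\pi$ in increasing order of their first entries; $\mathrm{RSP}(n)=\{\mathrm{runsort}(\sigma):\sigma\in S_n\}$. Equivalently, $R_n(t)=\sum_k f_{n,k}t^k$ where $f_{n,k}$ is the number of elements of $\mathrm{RSP}(n)$ with exactly $k$ runs. -}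

module Defs where

open import Data.Nat using (ℕ; zero; suc; _+_; _*_; _∸_; _<ᵇ_; _≤ᵇ_)
open import Data.Bool using (Bool; true; false; if_then_else_)
open import Data.List using (List; []; _∷_; map; concat; concatMap; length; filter; deduplicate)
open import Data.List.Properties using (≡-dec)
import Data.Nat.Properties as ℕP
open import Relation.Binary.PropositionalEquality using (_≡_)
open import Relation.Nullary.Decidable using (⌊_⌋)
open import Data.Nat using (_≟_)

insertAll : ℕ → List ℕ → List (List ℕ)
insertAll x [] = (x ∷ []) ∷ []
insertAll x (y ∷ ys) = (x ∷ y ∷ ys) ∷ map (y ∷_) (insertAll x ys)

-- S_n: all permutations of 1..n in one-line notation.
perms : ℕ → List (List ℕ)
perms zero = [] ∷ []
perms (suc n) = concatMap (insertAll (suc n)) (perms n)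

des : List ℕ → ℕ
des [] = 0
des (x ∷ []) = 0
des (x ∷ y ∷ ys) = (if y <ᵇ x then 1 else 0) + des (y ∷ ys)

runs : List ℕ → List (List ℕ)
runs [] = []
runs (x ∷ xs) with runs xs
... | [] = (x ∷ []) ∷ []
... | [] ∷ rs = (x ∷ []) ∷ [] ∷ rs
... | (y ∷ r) ∷ rs = if x <ᵇ y then (x ∷ y ∷ r) ∷ rs else (x ∷ []) ∷ (y ∷ r) ∷ rs

headOr0 : List ℕ → ℕ
headOr0 [] = 0
headOr0 (x ∷ _) = x

insertRun : List ℕ → List (List ℕ) → List (List ℕ)
insertRun r [] = r ∷ []
insertRun r (s ∷ ss) = if headOr0 r ≤ᵇ headOr0 s then r ∷ s ∷ ss else s ∷ insertRun r ss

sortRuns : List (List ℕ) → List (List ℕ)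
sortRuns [] = []
sortRuns (r ∷ rs) = insertRun r (sortRuns rs)

runsort : List ℕ → List ℕ
runsort π = concat (sortRuns (runs π))

RSP : ℕ → List (List ℕ)
RSP n = deduplicate (≡-dec _≟_) (map runsort (perms n))

-- Polynomials with ℕ coefficients, as coefficient functions (k ↦ coeff of t^k).
Poly : Set
Poly = ℕ → ℕ

R : ℕ → Poly
R n k = length (filter (λ π → suc (des π) ≟ k) (RSP n))

tPoly : Poly
tPoly (suc zero) = 1
tPoly _ = 0

deriv : Poly → Poly
deriv p k = suc k * p (suc k)

mulT : Poly → Poly
mulT p zero = 0
mulT p (suc k) = p k

scale : ℕ → Poly → Poly
scale c p k = c * p k

_⊕_ : Poly → Poly → Poly
(p ⊕ q) k = p k + q k

_≐_ : Poly → Poly → Set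
p ≐ q = ∀ k → p k ≡ q k

-- Write a set partition of {1,…,n} as the list of its blocks, each increasing, ordered by least
-- element, and call the boundary between consecutive blocks an ascent when the next block starts
-- above the end of the previous one. runsort(σ) lists the runs of σ by first entry; joining the
-- neighbours across every ascent turns them into an ascent-free partition with the same word, whose
-- blocks are then exactly the runs of that word. Conversely runsort fixes the word of an ascent-free
-- partition. So RSP(n) is in bijection with the ascent-free partitions of {1,…,n}, and des + 1 is the
-- number of blocks.
--
-- Let c(n,k,d) count partitions of {1,…,n} with k blocks and d ascents. For n ≥ 1, adding n + 1 at
-- the end of a block or as a new last block gives
--   c(n+1,k,d) = (k−d) c(n,k,d) + (d+1) c(n,k,d+1) + c(n,k−1,d−1),
-- and from this (d+1) c(n+1,k+1,d+1) = n c(n,k,d) by induction on n. At d = 0 the two identities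
-- combine into the recurrence for R_n, whose coefficient of t^k is c(n,k,0).
module Submission where

open import Defs
open import Data.Bool using (true; false; if_then_else_)
open import Data.Bool.Properties using (T-≡)
open import Data.Empty using (⊥; ⊥-elim)
open import Data.Unit using (⊤; tt)
open import Data.Nat using (ℕ; zero; suc; _+_; _*_; _∸_; _≤_; _<_; _≟_; _≡ᵇ_; _<ᵇ_; _≤ᵇ_; z≤n; s≤s)
open import Data.Nat.Properties
open import Data.Nat.Tactic.RingSolver using (solve-∀)
open import Data.Product using (_×_; _,_; proj₁; proj₂; ∃; ∃₂)
open import Data.Sum using (_⊎_; inj₁; inj₂)
open import Data.List using (List; []; _∷_; _++_; map; concat; concatMap; length; filter)
open import Data.List.Properties
  using (≡-dec; ++-assoc; ++-identityʳ; ∷-injectiveˡ; ∷-injectiveʳ; filter-all; filter-++; filter-accept; filter-reject)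
open import Data.List.Relation.Unary.All as All using (All; []; _∷_)
open import Data.List.Relation.Unary.All.Properties using (map⁺; concat⁺; ++⁺; ++⁻; ++⁻ʳ)
open import Data.List.Relation.Unary.Any using (here; there)
open import Data.List.Relation.Unary.Unique.Propositional using (Unique; []; _∷_)
import Data.List.Relation.Unary.Unique.Propositional.Properties as Unique
open import Data.List.Relation.Unary.Unique.DecPropositional.Properties (≡-dec _≟_) using (deduplicate-!)
open import Data.List.Membership.Propositional using (_∈_; find; lose)
open import Data.List.Membership.Propositional.Properties
  using (∈-++⁺ˡ; ∈-++⁺ʳ; ∈-map⁺; ∈-map⁻; ∈-concatMap⁺; ∈-concatMap⁻; ∈-∃++; ∈-insert;
         ∈-filter⁻; ∈-map∘filter⁺; ∈-map∘filter⁻; deduplicate-∈⇔)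
open import Data.List.Membership.Propositional.Properties.WithK using (unique∧set⇒bag)
open import Data.List.Relation.Binary.BagAndSetEquality using (∼bag⇒↭)
open import Data.List.Relation.Binary.Permutation.Propositional as ↭
  using (_↭_; ↭-refl; ↭-reflexive; ↭-sym; ↭-trans; prep; swap; ↭⇒↭ₛ)
open import Data.List.Relation.Binary.Permutation.Propositional.Properties
  using (↭-empty-inv; ∈-resp-↭; drop-mid; ++⁺ˡ; shifts; All-resp-↭; filter-↭; ↭-length)
open import Function using (_∘_)
open import Function.Bundles using (Equivalence; mk⇔)
open import Relation.Binary.PropositionalEquality
open import Relation.Binary.PropositionalEquality.Properties using () renaming (setoid to ≡-setoid)
open import Relation.Nullary using (¬_; ¬?; Dec; yes; no)
open import Relation.Nullary.Reflects using (ofʸ; ofⁿ)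
import Data.List.Relation.Binary.Permutation.Setoid.Properties (≡-setoid ℕ) as PermutationSetoid

∑ : {X : Set} → (X → ℕ) → List X → ℕ
∑ f [] = 0
∑ f (x ∷ xs) = f x + ∑ f xs

module _ {X : Set} where

  ∑-++ : (f : X → ℕ) (xs ys : List X) → ∑ f (xs ++ ys) ≡ ∑ f xs + ∑ f ys
  ∑-++ f [] ys = refl
  ∑-++ f (x ∷ xs) ys = trans (cong (f x +_) (∑-++ f xs ys)) (sym (+-assoc (f x) (∑ f xs) (∑ f ys)))

  ∑-cong : {f g : X → ℕ} {xs : List X} → All (λ x → f x ≡ g x) xs → ∑ f xs ≡ ∑ g xs
  ∑-cong [] = refl
  ∑-cong (e ∷ es) = cong₂ _+_ e (∑-cong es)

  ∑-+ : (f g : X → ℕ) (xs : List X) → ∑ (λ x → f x + g x) xs ≡ ∑ f xs + ∑ g xs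
  ∑-+ f g [] = refl
  ∑-+ f g (x ∷ xs) = trans (cong (f x + g x +_) (∑-+ f g xs)) (interchange (f x) (g x) (∑ f xs) (∑ g xs))
    where
    interchange : ∀ a b c e → a + b + (c + e) ≡ a + c + (b + e)
    interchange = solve-∀

  ∑-*ˡ : (c : ℕ) (f : X → ℕ) (xs : List X) → ∑ (λ x → c * f x) xs ≡ c * ∑ f xs
  ∑-*ˡ c f [] = sym (*-zeroʳ c)
  ∑-*ˡ c f (x ∷ xs) = trans (cong (c * f x +_) (∑-*ˡ c f xs)) (sym (*-distribˡ-+ c (f x) (∑ f xs)))

  ∑-zero : (xs : List X) → ∑ (λ _ → 0) xs ≡ 0
  ∑-zero [] = refl
  ∑-zero (x ∷ xs) = ∑-zero xs

module _ {X Y : Set} where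

  ∑-map : (f : Y → ℕ) (g : X → Y) (xs : List X) → ∑ f (map g xs) ≡ ∑ (f ∘ g) xs
  ∑-map f g [] = refl
  ∑-map f g (x ∷ xs) = cong (f (g x) +_) (∑-map f g xs)

  ∑-concatMap : (f : Y → ℕ) (g : X → List Y) (xs : List X) →
                ∑ f (concatMap g xs) ≡ ∑ (λ x → ∑ f (g x)) xs
  ∑-concatMap f g [] = refl
  ∑-concatMap f g (x ∷ xs) =
    trans (∑-++ f (g x) (concatMap g xs)) (cong (∑ f (g x) +_) (∑-concatMap f g xs))

  All-concatMap⁺ : {Q : Y → Set} {g : X → List Y} {xs : List X} →
                   All (λ x → All Q (g x)) xs → All Q (concatMap g xs)
  All-concatMap⁺ = concat⁺ ∘ map⁺

δ : ℕ → ℕ → ℕ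
δ a b = if a ≡ᵇ b then 1 else 0

δ-refl : ∀ a → δ a a ≡ 1
δ-refl zero = refl
δ-refl (suc a) = δ-refl a

δ-≢ : ∀ {a b} → a ≢ b → δ a b ≡ 0
δ-≢ {zero} {zero} a≢b = ⊥-elim (a≢b refl)
δ-≢ {zero} {suc b} _ = refl
δ-≢ {suc a} {zero} _ = refl
δ-≢ {suc a} {suc b} a≢b = δ-≢ (a≢b ∘ cong suc)

<⇒<ᵇ≡true : ∀ {m n} → m < n → (m <ᵇ n) ≡ true
<⇒<ᵇ≡true = Equivalence.to T-≡ ∘ <⇒<ᵇ

≥⇒<ᵇ≡false : ∀ {m n} → n ≤ m → (m <ᵇ n) ≡ false
≥⇒<ᵇ≡false z≤n = refl
≥⇒<ᵇ≡false (s≤s n≤m) = ≥⇒<ᵇ≡false n≤m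

≤⇒≤ᵇ≡true : ∀ {m n} → m ≤ n → (m ≤ᵇ n) ≡ true
≤⇒≤ᵇ≡true = Equivalence.to T-≡ ∘ ≤⇒≤ᵇ

-- Ordered set partitions and ascents between blocks

Nonempty : {X : Set} → List X → Set
Nonempty [] = ⊥
Nonempty (_ ∷ _) = ⊤

lastOr0 : List ℕ → ℕ
lastOr0 [] = 0
lastOr0 (x ∷ []) = x
lastOr0 (x ∷ y ∷ r) = lastOr0 (y ∷ r)

ascentAfter : List ℕ → List (List ℕ) → ℕ
ascentAfter B [] = 0
ascentAfter B (C ∷ _) = if headOr0 C <ᵇ lastOr0 B then 0 else 1

ascents : List (List ℕ) → ℕ
ascents [] = 0
ascents (B ∷ P) = ascentAfter B P + ascents P

insertMax : ℕ → List (List ℕ) → List (List (List ℕ))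
insertMax n [] = ((n ∷ []) ∷ []) ∷ []
insertMax n (B ∷ P) = ((B ++ n ∷ []) ∷ P) ∷ map (B ∷_) (insertMax n P)

-- The partitions of {1,…,n} into increasing blocks listed by increasing least element.
partitions : ℕ → List (List (List ℕ))
partitions zero = [] ∷ []
partitions (suc m) = concatMap (insertMax (suc m)) (partitions m)

χ : ℕ → ℕ → List (List ℕ) → ℕ
χ k d P = δ (length P) k * δ (ascents P) d

count : ℕ → ℕ → ℕ → ℕ
count n k d = ∑ (χ k d) (partitions n)

-- Counting partitions by blocks and ascents

BlockBelow : ℕ → List ℕ → Set
BlockBelow n B = Nonempty B × All (_< n) B

lastOr0-++-singleton : ∀ B n → lastOr0 (B ++ n ∷ []) ≡ n
lastOr0-++-singleton [] n = refl
lastOr0-++-singleton (x ∷ []) n = refl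
lastOr0-++-singleton (x ∷ y ∷ r) n = lastOr0-++-singleton (y ∷ r) n

lastOr0-< : ∀ {n} B → BlockBelow n B → lastOr0 B < n
lastOr0-< (x ∷ []) (_ , x<n ∷ _) = x<n
lastOr0-< (x ∷ y ∷ r) (_ , _ ∷ r<n) = lastOr0-< (y ∷ r) (tt , r<n)

headOr0-< : ∀ {n} B → BlockBelow n B → headOr0 B < n
headOr0-< (x ∷ r) (_ , x<n ∷ _) = x<n

ascentAfter≡0⊎1 : ∀ B P → ascentAfter B P ≡ 0 ⊎ ascentAfter B P ≡ 1
ascentAfter≡0⊎1 B [] = inj₁ refl
ascentAfter≡0⊎1 B (C ∷ P) with headOr0 C <ᵇ lastOr0 B
... | true = inj₁ refl
... | false = inj₂ refl

ascents≤length : ∀ P → ascents P ≤ length P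
ascents≤length [] = z≤n
ascents≤length (B ∷ P) = +-mono-≤ (ascentAfter≤1 (ascentAfter≡0⊎1 B P)) (ascents≤length P)
  where
  ascentAfter≤1 : ∀ {a} → a ≡ 0 ⊎ a ≡ 1 → a ≤ 1
  ascentAfter≤1 (inj₁ refl) = z≤n
  ascentAfter≤1 (inj₂ refl) = ≤-refl

ascentAfter-insertMax : ∀ n B C P → Nonempty C →
  All (λ X → ascentAfter B X ≡ ascentAfter B (C ∷ P)) (insertMax n (C ∷ P))
ascentAfter-insertMax n B (c ∷ C) P _ = refl ∷ map⁺ (All.universal (λ _ → refl) (insertMax n P))

-- Of the insertions of a new maximum into a partition with L blocks and G ascents, L ∸ G keep
-- both statistics, G destroy one ascent, and one creates a new block and a new ascent.
insertMaxCount : ℕ → ℕ → ℕ → ℕ → ℕ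
insertMaxCount L G k d = δ L k * (δ G d * (L ∸ G) + δ G (suc d) * G) + δ (suc L) k * δ (suc G) d

-- Inserting n into B ∷ P either appends it to B, leaving L + 1 blocks and removing the ascent after B,
-- or prefixes B to an insertion X into P, adding a block and the ascent f after B (unchanged, as X
-- starts with the first block of P).
insertMaxCount-cons : ∀ (Xs : List (List (List ℕ))) L G f → G ≤ L → f ≡ 0 ⊎ f ≡ 1 →
  (∀ k d → ∑ (χ k d) Xs ≡ insertMaxCount L G k d) → ∀ k d →
  δ (suc L) k * δ G d + ∑ (λ X → δ (suc (length X)) k * δ (f + ascents X) d) Xs
    ≡ insertMaxCount (suc L) (f + G) k d
insertMaxCount-cons Xs L G f G≤L f01 IH zero d = ∑-zero Xs
insertMaxCount-cons Xs L G .0 G≤L (inj₁ refl) IH (suc k) d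
  rewrite IH k d | +-∸-assoc 1 G≤L =
  arith (δ L k) (δ G d) (L ∸ G) (δ G (suc d) * G) (δ (suc L) k * δ (suc G) d)
  where
  arith : ∀ a b c e g → a * b + (a * (b * c + e) + g) ≡ a * (b * suc c + e) + g
  arith = solve-∀
insertMaxCount-cons Xs L G .1 G≤L (inj₂ refl) IH (suc k) zero
  rewrite ∑-cong {g = λ _ → 0} (All.universal (λ X → *-zeroʳ (δ (length X) k)) Xs) | ∑-zero Xs =
  cong₂ _+_ (cong (δ L k *_) (sym (δ-zero-*-suc G))) (sym (*-zeroʳ (δ (suc L) k)))
  where
  δ-zero-*-suc : ∀ G → δ G 0 * suc G ≡ δ G 0
  δ-zero-*-suc zero = refl
  δ-zero-*-suc (suc G) = refl
insertMaxCount-cons Xs L G .1 G≤L (inj₂ refl) IH (suc k) (suc d)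
  rewrite IH k d = arith (δ L k) (δ G (suc d)) (δ G d * (L ∸ G)) G (δ (suc L) k * δ (suc G) d)
  where
  arith : ∀ a e b G g → a * e + (a * (b + e * G) + g) ≡ a * (b + e * suc G) + g
  arith = solve-∀

∑χ-insertMax : ∀ n P → Nonempty P → All (BlockBelow n) P → ∀ k d →
  ∑ (χ k d) (insertMax n P) ≡ insertMaxCount (length P) (ascents P) k d
∑χ-insertMax n (B ∷ []) _ (B<n ∷ []) k d
  rewrite ≥⇒<ᵇ≡false (<⇒≤ (lastOr0-< B B<n)) = arith (δ 1 k) (δ 0 d) (δ 2 k) (δ 1 d)
  where
  arith : ∀ a b c e → a * b + (c * e + 0) ≡ a * (b * 1 + 0) + c * e
  arith = solve-∀
∑χ-insertMax n (B ∷ C ∷ P) _ (_ ∷ C<n ∷ P<n) k d = begin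
  ∑ (χ k d) (insertMax n (B ∷ C ∷ P))
    ≡⟨ cong₂ _+_ (cong (λ a → δ (2 + length P) k * δ (a + ascents (C ∷ P)) d) appended-no-ascent)
                 (∑-map (χ k d) (B ∷_) (insertMax n (C ∷ P))) ⟩
  δ (2 + length P) k * δ (ascents (C ∷ P)) d + ∑ (χ k d ∘ (B ∷_)) (insertMax n (C ∷ P))
    ≡⟨ cong (δ (2 + length P) k * δ (ascents (C ∷ P)) d +_) (∑-cong (All.map
         (λ {X} e → cong (λ a → δ (suc (length X)) k * δ (a + ascents X) d) e)
         (ascentAfter-insertMax n B C P (proj₁ C<n)))) ⟩
  δ (2 + length P) k * δ (ascents (C ∷ P)) d
    + ∑ (λ X → δ (suc (length X)) k * δ (ascentAfter B (C ∷ P) + ascents X) d) (insertMax n (C ∷ P))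
    ≡⟨ insertMaxCount-cons (insertMax n (C ∷ P)) (length (C ∷ P)) (ascents (C ∷ P)) (ascentAfter B (C ∷ P))
         (ascents≤length (C ∷ P)) (ascentAfter≡0⊎1 B (C ∷ P))
         (∑χ-insertMax n (C ∷ P) tt (C<n ∷ P<n)) k d ⟩
  insertMaxCount (length (B ∷ C ∷ P)) (ascents (B ∷ C ∷ P)) k d ∎
  where
  open ≡-Reasoning
  appended-no-ascent : ascentAfter (B ++ n ∷ []) (C ∷ P) ≡ 0
  appended-no-ascent rewrite lastOr0-++-singleton B n | <⇒<ᵇ≡true (headOr0-< C C<n) = refl

δ-coefficients : ∀ L G k d → δ L k * (δ G d * (L ∸ G) + δ G (suc d) * G)
                              ≡ (k ∸ d) * (δ L k * δ G d) + suc d * (δ L k * δ G (suc d))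
δ-coefficients L G k d with L ≟ k
... | no L≢k rewrite δ-≢ L≢k | *-zeroʳ (k ∸ d) | *-zeroʳ d = refl
... | yes refl rewrite δ-refl L with G ≟ d
...   | yes refl rewrite δ-refl G | δ-≢ (<⇒≢ (n<1+n G)) = arith (L ∸ G) G
  where
  arith : ∀ x G → 1 * (1 * x + 0 * G) ≡ x * (1 * 1) + suc G * (1 * 0)
  arith = solve-∀
...   | no G≢d rewrite δ-≢ G≢d with G ≟ suc d
...     | yes refl rewrite δ-refl (suc d) = arith (L ∸ d) d
  where
  arith : ∀ x d → 1 * suc d + 0 ≡ x * 0 + (1 + 0 + d * (1 + 0))
  arith = solve-∀
...     | no G≢1+d rewrite δ-≢ G≢1+d | *-zeroʳ (L ∸ d) | *-zeroʳ d = refl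

χ⁺ : ℕ → ℕ → List (List ℕ) → ℕ
χ⁺ k d P = δ (suc (length P)) k * δ (suc (ascents P)) d

count↓ : ℕ → ℕ → ℕ → ℕ
count↓ n (suc k) (suc d) = count n k d
count↓ n _ _ = 0

∑χ⁺ : ∀ n k d → ∑ (χ⁺ k d) (partitions n) ≡ count↓ n k d
∑χ⁺ n zero d = ∑-zero (partitions n)
∑χ⁺ n (suc k) zero =
  trans (∑-cong (All.universal (λ P → *-zeroʳ (δ (length P) k)) (partitions n))) (∑-zero (partitions n))
∑χ⁺ n (suc k) (suc d) = refl

insertMax-below : ∀ n P → All (BlockBelow n) P →
  All (λ X → Nonempty X × All (BlockBelow (suc n)) X) (insertMax n P)
insertMax-below n [] [] = (tt , (tt , n<1+n n ∷ []) ∷ []) ∷ []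
insertMax-below n (B ∷ P) ((B≢[] , B<n) ∷ P<n) =
  (tt , (appended-nonempty B B≢[] , ++⁺ (All.map m<n⇒m<1+n B<n) (n<1+n n ∷ []))
        ∷ All.map BlockBelow-suc P<n)
  ∷ map⁺ (All.map (λ (_ , X<1+n) → tt , BlockBelow-suc (B≢[] , B<n) ∷ X<1+n) (insertMax-below n P P<n))
  where
  BlockBelow-suc : ∀ {C} → BlockBelow n C → BlockBelow (suc n) C
  BlockBelow-suc (C≢[] , C<n) = C≢[] , All.map m<n⇒m<1+n C<n
  appended-nonempty : ∀ B → Nonempty B → Nonempty (B ++ n ∷ [])
  appended-nonempty (_ ∷ _) _ = tt

partitions-below : ∀ m → All (All (BlockBelow (suc m))) (partitions m)
partitions-below zero = [] ∷ []
partitions-below (suc m) =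
  All-concatMap⁺ (All.map (λ {P} P<1+m → All.map proj₂ (insertMax-below (suc m) P P<1+m)) (partitions-below m))

partitions-nonempty : ∀ m → All Nonempty (partitions (suc m))
partitions-nonempty m =
  All-concatMap⁺ (All.map (λ {P} P<1+m → All.map proj₁ (insertMax-below (suc m) P P<1+m)) (partitions-below m))

count-rec : ∀ m k d → count (2 + m) k d
  ≡ (k ∸ d) * count (suc m) k d + suc d * count (suc m) k (suc d) + count↓ (suc m) k d
count-rec m k d = begin
  count (2 + m) k d
    ≡⟨ ∑-concatMap (χ k d) (insertMax (2 + m)) Ps ⟩
  ∑ (λ P → ∑ (χ k d) (insertMax (2 + m) P)) Ps
    ≡⟨ ∑-cong (All.zipWith (λ {P} (P≢[] , P<2+m) → ∑χ-insertMax (2 + m) P P≢[] P<2+m k d)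
                           (partitions-nonempty m , partitions-below (suc m))) ⟩
  ∑ (λ P → insertMaxCount (length P) (ascents P) k d) Ps
    ≡⟨ ∑-cong (All.universal (λ P → cong (_+ χ⁺ k d P) (δ-coefficients (length P) (ascents P) k d)) Ps) ⟩
  ∑ (λ P → (k ∸ d) * χ k d P + suc d * χ k (suc d) P + χ⁺ k d P) Ps
    ≡⟨ ∑-+ _ (χ⁺ k d) Ps ⟩
  ∑ (λ P → (k ∸ d) * χ k d P + suc d * χ k (suc d) P) Ps + ∑ (χ⁺ k d) Ps
    ≡⟨ cong₂ _+_ (trans (∑-+ _ _ Ps)
                        (cong₂ _+_ (∑-*ˡ (k ∸ d) (χ k d) Ps) (∑-*ˡ (suc d) (χ k (suc d)) Ps)))
                 (∑χ⁺ (suc m) k d) ⟩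
  (k ∸ d) * count (suc m) k d + suc d * count (suc m) k (suc d) + count↓ (suc m) k d ∎
  where
  open ≡-Reasoning
  Ps : List (List (List ℕ))
  Ps = partitions (suc m)

count-no-blocks : ∀ m d → count (suc m) 0 d ≡ 0
count-no-blocks m d =
  trans (∑-cong (All.map (λ { {_ ∷ _} _ → refl }) (partitions-nonempty m))) (∑-zero (partitions (suc m)))

count-1-ascents : ∀ k d → count 1 k (suc d) ≡ 0
count-1-ascents k d = cong (_+ 0) (*-zeroʳ (δ 1 k))

count-ascent-shift : ∀ p k d → suc d * count (suc p) (suc k) (suc d) ≡ p * count p k d
count-ascent-shift zero k d rewrite count-1-ascents (suc k) d = *-zeroʳ d
count-ascent-shift (suc zero) k d = trans (cong (suc d *_) count-2) (count-1-weighted d)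
  where
  count-2 : count 2 (suc k) (suc d) ≡ count 1 k d
  count-2 rewrite count-rec 0 (suc k) (suc d) | count-1-ascents (suc k) d
                | *-zeroʳ (k ∸ d) | *-zeroʳ (suc (suc d)) = refl
  count-1-weighted : ∀ d → suc d * count 1 k d ≡ 1 * count 1 k d
  count-1-weighted zero = refl
  count-1-weighted (suc d) rewrite count-1-ascents k d | *-zeroʳ d = refl
count-ascent-shift (suc (suc q)) k d = begin
  suc d * count (3 + q) (suc k) (suc d)
    ≡⟨ cong (suc d *_) (count-rec (suc q) (suc k) (suc d)) ⟩
  suc d * ((k ∸ d) * X + suc (suc d) * Y + Z)
    ≡⟨ distribute d (k ∸ d) X Y Z ⟩
  (k ∸ d) * (suc d * X) + suc d * (suc (suc d) * Y) + Z + d * Z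
    ≡⟨ cong₂ (λ u v → (k ∸ d) * u + suc d * v + Z + d * Z)
             (count-ascent-shift (suc q) k d) (count-ascent-shift (suc q) k (suc d)) ⟩
  (k ∸ d) * (s * a) + suc d * (s * b) + Z + d * Z
    ≡⟨ cong ((k ∸ d) * (s * a) + suc d * (s * b) + Z +_) (weighted-Z k d) ⟩
  (k ∸ d) * (s * a) + suc d * (s * b) + Z + s * e
    ≡⟨ collect (k ∸ d) d s a b e Z ⟩
  s * ((k ∸ d) * a + suc d * b + e) + Z
    ≡⟨ cong (λ u → s * u + Z) (sym (count-rec q k d)) ⟩
  s * Z + Z
    ≡⟨ +-comm (s * Z) Z ⟩
  suc s * Z ∎
  where
  open ≡-Reasoning
  s X Y Z a b e : ℕ
  s = suc q
  X = count (2 + q) (suc k) (suc d)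
  Y = count (2 + q) (suc k) (2 + d)
  Z = count (2 + q) k d
  a = count (suc q) k d
  b = count (suc q) k (suc d)
  e = count↓ (suc q) k d
  distribute : ∀ d c X Y Z → suc d * (c * X + suc (suc d) * Y + Z)
                             ≡ c * (suc d * X) + suc d * (suc (suc d) * Y) + Z + d * Z
  distribute = solve-∀
  collect : ∀ c d s a b e Z → c * (s * a) + suc d * (s * b) + Z + s * e ≡ s * (c * a + suc d * b + e) + Z
  collect = solve-∀
  weighted-Z : ∀ k d → d * count (2 + q) k d ≡ s * count↓ (suc q) k d
  weighted-Z zero zero = sym (*-zeroʳ s)
  weighted-Z (suc k) zero = sym (*-zeroʳ s)
  weighted-Z zero (suc d) rewrite count-no-blocks (suc q) (suc d) | *-zeroʳ d = sym (*-zeroʳ s)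
  weighted-Z (suc k) (suc d) = count-ascent-shift (suc q) k d

-- Runs and descents of a concatenation of blocks

Increasing : List ℕ → Set
Increasing [] = ⊤
Increasing (x ∷ []) = ⊤
Increasing (x ∷ y ∷ r) = x < y × Increasing (y ∷ r)

IncreasingBlocks : List (List ℕ) → Set
IncreasingBlocks = All (λ B → Nonempty B × Increasing B)

noAscent⇒< : ∀ B C P → ascentAfter B (C ∷ P) ≡ 0 → headOr0 C < lastOr0 B
noAscent⇒< B C P e with headOr0 C <ᵇ lastOr0 B | <ᵇ-reflects-< (headOr0 C) (lastOr0 B)
... | true | ofʸ C<B = C<B
... | false | _ with () ← e

<⇒noAscent : ∀ B C P → headOr0 C < lastOr0 B → ascentAfter B (C ∷ P) ≡ 0
<⇒noAscent B C P C<B rewrite <⇒<ᵇ≡true C<B = refl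

ascentAfter-∷ : ∀ x y B P → ascentAfter (x ∷ y ∷ B) P ≡ ascentAfter (y ∷ B) P
ascentAfter-∷ x y B [] = refl
ascentAfter-∷ x y B (C ∷ P) = refl

consRun : ℕ → List (List ℕ) → List (List ℕ)
consRun x [] = (x ∷ []) ∷ []
consRun x ([] ∷ rs) = (x ∷ []) ∷ [] ∷ rs
consRun x ((y ∷ r) ∷ rs) = if x <ᵇ y then (x ∷ y ∷ r) ∷ rs else (x ∷ []) ∷ (y ∷ r) ∷ rs

runs-∷ : ∀ x xs → runs (x ∷ xs) ≡ consRun x (runs xs)
runs-∷ x xs with runs xs
... | [] = refl
... | [] ∷ rs = refl
... | (y ∷ r) ∷ rs = refl

runs-increasing : ∀ σ → IncreasingBlocks (runs σ)
runs-increasing [] = []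
runs-increasing (x ∷ xs) rewrite runs-∷ x xs = consRun-increasing (runs xs) (runs-increasing xs)
  where
  consRun-increasing : ∀ rs → IncreasingBlocks rs → IncreasingBlocks (consRun x rs)
  consRun-increasing [] [] = (tt , tt) ∷ []
  consRun-increasing ((y ∷ r) ∷ rs) ((_ , r↑) ∷ rs↑) with x <ᵇ y | <ᵇ-reflects-< x y
  ... | true | ofʸ x<y = (tt , x<y , r↑) ∷ rs↑
  ... | false | _ = (tt , tt) ∷ (tt , r↑) ∷ rs↑

concat-runs : ∀ σ → concat (runs σ) ≡ σ
concat-runs [] = refl
concat-runs (x ∷ xs) rewrite runs-∷ x xs = trans (concat-consRun (runs xs)) (cong (x ∷_) (concat-runs xs))
  where
  concat-consRun : ∀ rs → concat (consRun x rs) ≡ x ∷ concat rs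
  concat-consRun [] = refl
  concat-consRun ([] ∷ rs) = refl
  concat-consRun ((y ∷ r) ∷ rs) with x <ᵇ y
  ... | true = refl
  ... | false = refl

runs-++ : ∀ B P → Nonempty B → Increasing B → IncreasingBlocks P →
          runs (concat P) ≡ P → ascentAfter B P ≡ 0 → runs (B ++ concat P) ≡ B ∷ P
runs-++ (x ∷ []) [] _ _ _ runs-P _ rewrite runs-∷ x [] = refl
runs-++ (x ∷ []) ((y ∷ r) ∷ P) _ _ _ runs-P no-ascent
  rewrite runs-∷ x (concat ((y ∷ r) ∷ P)) | runs-P
        | ≥⇒<ᵇ≡false (<⇒≤ (noAscent⇒< (x ∷ []) (y ∷ r) P no-ascent)) = refl
runs-++ (x ∷ []) ([] ∷ P) _ _ ((() , _) ∷ _) _ _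
runs-++ (x ∷ y ∷ B) P _ (x<y , B↑) P↑ runs-P no-ascent = begin
  runs (x ∷ y ∷ B ++ concat P)          ≡⟨ runs-∷ x (y ∷ B ++ concat P) ⟩
  consRun x (runs (y ∷ B ++ concat P))  ≡⟨ cong (consRun x) (runs-++ (y ∷ B) P tt B↑ P↑ runs-P
                                              (trans (sym (ascentAfter-∷ x y B P)) no-ascent)) ⟩
  consRun x ((y ∷ B) ∷ P)               ≡⟨ cong (λ b → if b then (x ∷ y ∷ B) ∷ P else (x ∷ []) ∷ (y ∷ B) ∷ P)
                                              (<⇒<ᵇ≡true x<y) ⟩
  (x ∷ y ∷ B) ∷ P                       ∎
  where open ≡-Reasoning

runs-concat : ∀ P → IncreasingBlocks P → ascents P ≡ 0 → runs (concat P) ≡ P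
runs-concat [] _ _ = refl
runs-concat (B ∷ P) ((B≢[] , B↑) ∷ P↑) no-ascents =
  runs-++ B P B≢[] B↑ P↑ (runs-concat P P↑ (m+n≡0⇒n≡0 (ascentAfter B P) no-ascents))
          (m+n≡0⇒m≡0 (ascentAfter B P) no-ascents)

des-concat : ∀ B P → IncreasingBlocks (B ∷ P) → ascents (B ∷ P) ≡ 0 →
             suc (des (concat (B ∷ P))) ≡ length (B ∷ P)
des-concat [] P ((() , _) ∷ _) _
des-concat (x ∷ []) [] _ _ = refl
des-concat (x ∷ []) ([] ∷ P) (_ ∷ (() , _) ∷ _) _
des-concat (x ∷ []) ((y ∷ r) ∷ P) (_ ∷ P↑) no-ascents
  rewrite <⇒<ᵇ≡true (noAscent⇒< (x ∷ []) (y ∷ r) P (m+n≡0⇒m≡0 (ascentAfter (x ∷ []) ((y ∷ r) ∷ P)) no-ascents))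
  = cong suc (des-concat (y ∷ r) P P↑ (m+n≡0⇒n≡0 (ascentAfter (x ∷ []) ((y ∷ r) ∷ P)) no-ascents))
des-concat (x ∷ y ∷ B) P ((_ , x<y , B↑) ∷ P↑) no-ascents =
  trans (cong (λ b → suc ((if b then 1 else 0) + des (y ∷ B ++ concat P))) (≥⇒<ᵇ≡false (<⇒≤ x<y)))
        (des-concat (y ∷ B) P ((tt , B↑) ∷ P↑)
                    (trans (cong (_+ ascents P) (sym (ascentAfter-∷ x y B P))) no-ascents))

-- Sorting and joining runs

HeadBelow : List ℕ → List (List ℕ) → Set
HeadBelow B [] = ⊤
HeadBelow B (C ∷ _) = headOr0 B ≤ headOr0 C

HeadsSorted : List (List ℕ) → Set
HeadsSorted [] = ⊤
HeadsSorted (B ∷ P) = HeadBelow B P × HeadsSorted P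

firstHead : List (List ℕ) → ℕ
firstHead [] = 0
firstHead (B ∷ _) = headOr0 B

insertRun-↭ : ∀ r ss → insertRun r ss ↭ r ∷ ss
insertRun-↭ r [] = ↭-refl
insertRun-↭ r (s ∷ ss) with headOr0 r ≤ᵇ headOr0 s
... | true = ↭-refl
... | false = ↭-trans (prep s (insertRun-↭ r ss)) (swap s r ↭-refl)

sortRuns-↭ : ∀ rs → sortRuns rs ↭ rs
sortRuns-↭ [] = ↭-refl
sortRuns-↭ (r ∷ rs) = ↭-trans (insertRun-↭ r (sortRuns rs)) (prep r (sortRuns-↭ rs))

insertRun-sorted : ∀ r ss → HeadsSorted ss → HeadsSorted (insertRun r ss)
insertRun-sorted r [] _ = tt , tt
insertRun-sorted r (s ∷ ss) (s≤ss , ss-sorted)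
  with headOr0 r ≤ᵇ headOr0 s | ≤ᵇ-reflects-≤ (headOr0 r) (headOr0 s)
... | true | ofʸ r≤s = r≤s , s≤ss , ss-sorted
... | false | ofⁿ r≰s = HeadBelow-insertRun ss (<⇒≤ (≰⇒> r≰s)) s≤ss , insertRun-sorted r ss ss-sorted
  where
  HeadBelow-insertRun : ∀ ss → headOr0 s ≤ headOr0 r → HeadBelow s ss → HeadBelow s (insertRun r ss)
  HeadBelow-insertRun [] s≤r _ = s≤r
  HeadBelow-insertRun (t ∷ ss) s≤r s≤t with headOr0 r ≤ᵇ headOr0 t
  ... | true = s≤r
  ... | false = s≤t

sortRuns-sorted : ∀ rs → HeadsSorted (sortRuns rs)
sortRuns-sorted [] = tt
sortRuns-sorted (r ∷ rs) = insertRun-sorted r (sortRuns rs) (sortRuns-sorted rs)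

sortRuns-sorted-id : ∀ P → HeadsSorted P → sortRuns P ≡ P
sortRuns-sorted-id [] _ = refl
sortRuns-sorted-id (B ∷ []) _ = refl
sortRuns-sorted-id (B ∷ C ∷ P) (B≤C , CP-sorted)
  rewrite sortRuns-sorted-id (C ∷ P) CP-sorted | ≤⇒≤ᵇ≡true B≤C = refl

lastOr0-∈ : ∀ B → Nonempty B → lastOr0 B ∈ B
lastOr0-∈ (x ∷ []) _ = here refl
lastOr0-∈ (x ∷ y ∷ r) _ = there (lastOr0-∈ (y ∷ r) tt)

headOr0-∈ : ∀ C → Nonempty C → headOr0 C ∈ C
headOr0-∈ (x ∷ r) _ = here refl

lastOr0-++ : ∀ B C → Nonempty C → lastOr0 (B ++ C) ≡ lastOr0 C
lastOr0-++ [] C _ = refl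
lastOr0-++ (x ∷ []) (y ∷ C) _ = refl
lastOr0-++ (x ∷ x′ ∷ B) C C≢[] = lastOr0-++ (x′ ∷ B) C C≢[]

ascentAfter-++ : ∀ B C T → Nonempty C → ascentAfter (B ++ C) T ≡ ascentAfter C T
ascentAfter-++ B C [] _ = refl
ascentAfter-++ B C (D ∷ T) C≢[] rewrite lastOr0-++ B C C≢[] = refl

Increasing-++ : ∀ B C → Nonempty B → Nonempty C → Increasing B → Increasing C →
                lastOr0 B < headOr0 C → Increasing (B ++ C)
Increasing-++ (x ∷ []) (y ∷ C) _ _ _ C↑ x<y = x<y , C↑
Increasing-++ (x ∷ x′ ∷ B) C _ C≢[] (x<x′ , B↑) C↑ B<C = x<x′ , Increasing-++ (x′ ∷ B) C tt C≢[] B↑ C↑ B<C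

HeadBelow-trans : ∀ {B C} T → headOr0 B ≤ headOr0 C → HeadBelow C T → HeadBelow B T
HeadBelow-trans [] _ _ = tt
HeadBelow-trans (D ∷ T) B≤C C≤D = ≤-trans B≤C C≤D

Unique-++⁻ʳ : ∀ (xs : List ℕ) {ys} → Unique (xs ++ ys) → Unique ys
Unique-++⁻ʳ [] u = u
Unique-++⁻ʳ (x ∷ xs) (_ ∷ u) = Unique-++⁻ʳ xs u

Unique-++⇒≢ : ∀ {xs ys : List ℕ} {x y} → Unique (xs ++ ys) → x ∈ xs → y ∈ ys → x ≢ y
Unique-++⇒≢ {_ ∷ xs} (x≢ ∷ _) (here refl) y∈ys = All.lookup x≢ (∈-++⁺ʳ xs y∈ys)
Unique-++⇒≢ (_ ∷ u) (there x∈xs) y∈ys = Unique-++⇒≢ u x∈xs y∈ys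

joinAscent : List ℕ → List (List ℕ) → List (List ℕ)
joinAscent B [] = B ∷ []
joinAscent B (C ∷ T) = if headOr0 C <ᵇ lastOr0 B then B ∷ C ∷ T else (B ++ C) ∷ T

joinAscents : List (List ℕ) → List (List ℕ)
joinAscents [] = []
joinAscents (B ∷ S) = joinAscent B (joinAscents S)

record Regrouping (S T : List (List ℕ)) : Set where
  constructor regrouping
  field
    increasing : IncreasingBlocks T
    sorted : HeadsSorted T
    noAscents : ascents T ≡ 0
    sameWord : concat T ≡ concat S
    sameFirstHead : firstHead T ≡ firstHead S

HeadBelow-regrouping : ∀ B S {C T} → HeadBelow B S → Regrouping S (C ∷ T) → headOr0 B ≤ headOr0 C
HeadBelow-regrouping B [] {[]} _ (regrouping ((() , _) ∷ _) _ _ _ _)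
HeadBelow-regrouping B [] {_ ∷ _} _ (regrouping _ _ _ () _)
HeadBelow-regrouping B (D ∷ S) B≤D (regrouping _ _ _ _ same-head) = subst (headOr0 B ≤_) (sym same-head) B≤D

joinAscent-regrouping : ∀ B S T → Nonempty B → Increasing B → HeadBelow B S → Unique (B ++ concat S) →
                        Regrouping S T → Regrouping (B ∷ S) (joinAscent B T)
joinAscent-regrouping B S [] B≢[] B↑ _ _ (regrouping _ _ _ same _) =
  regrouping ((B≢[] , B↑) ∷ []) (tt , tt) refl (cong (B ++_) same) refl
joinAscent-regrouping (b ∷ B) S (C ∷ T) _ B↑ B≤S u
  r@(regrouping ((C≢[] , C↑) ∷ T↑) (C≤T , T-sorted) no-ascents same _)
  with headOr0 C <ᵇ lastOr0 (b ∷ B) | <ᵇ-reflects-< (headOr0 C) (lastOr0 (b ∷ B))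
... | true | ofʸ C<B =
  regrouping ((tt , B↑) ∷ (C≢[] , C↑) ∷ T↑) (HeadBelow-regrouping (b ∷ B) S B≤S r , C≤T , T-sorted)
             (trans (cong (_+ ascents (C ∷ T)) (<⇒noAscent (b ∷ B) C T C<B)) no-ascents)
             (cong ((b ∷ B) ++_) same) refl
... | false | ofⁿ C≮B =
  regrouping ((tt , Increasing-++ (b ∷ B) C tt C≢[] B↑ C↑ B<C) ∷ T↑)
             (HeadBelow-trans T (HeadBelow-regrouping (b ∷ B) S B≤S r) C≤T , T-sorted)
             (trans (cong (_+ ascents T) (ascentAfter-++ (b ∷ B) C T C≢[])) no-ascents)
             (trans (++-assoc (b ∷ B) C (concat T)) (cong ((b ∷ B) ++_) same)) refl
  where
  B<C : lastOr0 (b ∷ B) < headOr0 C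
  B<C = ≤∧≢⇒< (≮⇒≥ C≮B)
          (Unique-++⇒≢ u (lastOr0-∈ (b ∷ B) tt) (subst (headOr0 C ∈_) same (∈-++⁺ˡ (headOr0-∈ C C≢[]))))

joinAscents-regrouping : ∀ S → IncreasingBlocks S → HeadsSorted S → Unique (concat S) →
                         Regrouping S (joinAscents S)
joinAscents-regrouping [] _ _ _ = regrouping [] tt refl refl refl
joinAscents-regrouping (B ∷ S) ((B≢[] , B↑) ∷ S↑) (B≤S , S-sorted) u =
  joinAscent-regrouping B S (joinAscents S) B≢[] B↑ B≤S u
    (joinAscents-regrouping S S↑ S-sorted (Unique-++⁻ʳ B u))

∈-concatMap-intro : {X Y : Set} {f : X → List Y} {xs : List X} {x : X} {y : Y} →
                    x ∈ xs → y ∈ f x → y ∈ concatMap f xs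
∈-concatMap-intro {f = f} x∈xs y∈fx = ∈-concatMap⁺ f (lose x∈xs y∈fx)

∈-concatMap-elim : {X Y : Set} {f : X → List Y} {xs : List X} {y : Y} →
                   y ∈ concatMap f xs → ∃ λ x → x ∈ xs × y ∈ f x
∈-concatMap-elim {f = f} = find ∘ ∈-concatMap⁻ f

insertAll-All : ∀ {Q : ℕ → Set} x ys → Q x → All Q ys → All (All Q) (insertAll x ys)
insertAll-All x [] Qx [] = (Qx ∷ []) ∷ []
insertAll-All x (y ∷ ys) Qx (Qy ∷ Qys) = (Qx ∷ Qy ∷ Qys) ∷ map⁺ (All.map (Qy ∷_) (insertAll-All x ys Qx Qys))

insertAll-unique : ∀ x ys → All (x ≢_) ys → Unique ys → All Unique (insertAll x ys)
insertAll-unique x [] _ _ = ([] ∷ []) ∷ []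
insertAll-unique x (y ∷ ys) (x≢y ∷ x∉ys) (y∉ys ∷ ys!) =
  ((x≢y ∷ x∉ys) ∷ y∉ys ∷ ys!)
  ∷ map⁺ (All.zipWith (λ (y∉ , u) → y∉ ∷ u)
                      (insertAll-All x ys (x≢y ∘ sym) y∉ys , insertAll-unique x ys x∉ys ys!))

∈-insertAll : ∀ x a b → a ++ x ∷ b ∈ insertAll x (a ++ b)
∈-insertAll x [] [] = here refl
∈-insertAll x [] (y ∷ b) = here refl
∈-insertAll x (y ∷ a) b = there (∈-map⁺ (y ∷_) (∈-insertAll x a b))

∈-insertAll⁻ : ∀ x ys {zs} → zs ∈ insertAll x ys → ∃₂ λ a b → ys ≡ a ++ b × zs ≡ a ++ x ∷ b
∈-insertAll⁻ x [] (here refl) = [] , [] , refl , refl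
∈-insertAll⁻ x (y ∷ ys) (here refl) = [] , y ∷ ys , refl , refl
∈-insertAll⁻ x (y ∷ ys) (there zs∈) with ∈-map⁻ (y ∷_) zs∈
... | zs′ , zs′∈ , refl with ∈-insertAll⁻ x ys zs′∈
...   | a , b , refl , refl = y ∷ a , b , refl , refl

perms-below : ∀ n → All (All (_< suc n)) (perms n)
perms-below zero = [] ∷ []
perms-below (suc n) =
  All-concatMap⁺ (All.map (λ {ys} ys<1+n → insertAll-All (suc n) ys ≤-refl (All.map m<n⇒m<1+n ys<1+n))
                          (perms-below n))

perms-unique : ∀ n → All Unique (perms n)
perms-unique zero = [] ∷ []
perms-unique (suc n) = All-concatMap⁺ (All.zipWith
  (λ {ys} (ys<1+n , ys!) → insertAll-unique (suc n) ys (All.map (λ y<1+n → ≢-sym (<⇒≢ y<1+n)) ys<1+n) ys!)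
  (perms-below n , perms-unique n))

perms-↭-closed : ∀ n {τ σ} → τ ↭ σ → σ ∈ perms n → τ ∈ perms n
perms-↭-closed zero τ↭[] (here refl) rewrite ↭-empty-inv τ↭[] = here refl
perms-↭-closed (suc m) τ↭σ σ∈ with ∈-concatMap-elim σ∈
... | ρ , ρ∈ , σ∈′ with ∈-insertAll⁻ (suc m) ρ σ∈′
...   | a , b , refl , refl with ∈-∃++ (∈-resp-↭ (↭-sym τ↭σ) (∈-insert a))
...     | c , d , refl = ∈-concatMap-intro (perms-↭-closed m (drop-mid c a τ↭σ) ρ∈) (∈-insertAll (suc m) c d)

-- The enumeration of partitions

∈-insertMax⁻ : ∀ n P {X} → X ∈ insertMax n P → ∃₂ λ a b → concat P ≡ a ++ b × concat X ≡ a ++ n ∷ b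
∈-insertMax⁻ n [] (here refl) = [] , [] , refl , refl
∈-insertMax⁻ n (B ∷ P) (here refl) = B , concat P , refl , ++-assoc B (n ∷ []) (concat P)
∈-insertMax⁻ n (B ∷ P) (there X∈) with ∈-map⁻ (B ∷_) X∈
... | X′ , X′∈ , refl with ∈-insertMax⁻ n P X′∈
...   | a , b , P≡ab , X′≡anb = B ++ a , b , trans (cong (B ++_) P≡ab) (sym (++-assoc B a b))
                                           , trans (cong (B ++_) X′≡anb) (sym (++-assoc B a (n ∷ b)))

concat-partitions : ∀ n {P} → P ∈ partitions n → concat P ∈ perms n
concat-partitions zero (here refl) = here refl
concat-partitions (suc m) P∈ with ∈-concatMap-elim P∈
... | Q , Q∈ , P∈′ with ∈-insertMax⁻ (suc m) Q P∈′
...   | a , b , Q≡ab , P≡anb rewrite P≡anb =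
  ∈-concatMap-intro (subst (_∈ perms m) Q≡ab (concat-partitions m Q∈)) (∈-insertAll (suc m) a b)

insertMax-HeadBelow : ∀ n B C P → Nonempty C → HeadBelow B (C ∷ P) → All (HeadBelow B) (insertMax n (C ∷ P))
insertMax-HeadBelow n B (c ∷ C) P _ B≤c = B≤c ∷ map⁺ (All.universal (λ _ → B≤c) (insertMax n P))

insertMax-sorted : ∀ n P → All (BlockBelow n) P → IncreasingBlocks P → HeadsSorted P →
                   All (λ X → IncreasingBlocks X × HeadsSorted X) (insertMax n P)
insertMax-sorted n [] _ _ _ = ((tt , tt) ∷ [] , tt , tt) ∷ []
insertMax-sorted n ((b ∷ B) ∷ P) ((_ , B<n) ∷ P<n) ((_ , B↑) ∷ P↑) (B≤P , P-sorted) =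
  ((tt , Increasing-++ (b ∷ B) (n ∷ []) tt tt B↑ tt (lastOr0-< (b ∷ B) (tt , B<n))) ∷ P↑ ,
   HeadBelow-snoc P B≤P , P-sorted)
  ∷ map⁺ (All.zipWith (λ (B≤X , X↑ , X-sorted) → (tt , B↑) ∷ X↑ , B≤X , X-sorted)
                      (HeadBelow-insertMax P P<n P↑ B≤P , insertMax-sorted n P P<n P↑ P-sorted))
  where
  HeadBelow-snoc : ∀ P → HeadBelow (b ∷ B) P → HeadBelow ((b ∷ B) ++ n ∷ []) P
  HeadBelow-snoc [] _ = tt
  HeadBelow-snoc (C ∷ P) b≤C = b≤C
  HeadBelow-insertMax : ∀ P → All (BlockBelow n) P → IncreasingBlocks P → HeadBelow (b ∷ B) P →
                        All (HeadBelow (b ∷ B)) (insertMax n P)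
  HeadBelow-insertMax [] _ _ _ = <⇒≤ (headOr0-< (b ∷ B) (tt , B<n)) ∷ []
  HeadBelow-insertMax (C ∷ P) _ ((C≢[] , _) ∷ _) b≤C = insertMax-HeadBelow n (b ∷ B) C P C≢[] b≤C

partitions-sorted : ∀ m → All (λ P → IncreasingBlocks P × HeadsSorted P) (partitions m)
partitions-sorted zero = ([] , tt) ∷ []
partitions-sorted (suc m) = All-concatMap⁺ (All.zipWith
  (λ {P} (P<1+m , P↑ , P-sorted) → insertMax-sorted (suc m) P P<1+m P↑ P-sorted)
  (partitions-below m , partitions-sorted m))

without : ℕ → List ℕ → List ℕ
without n = filter (λ x → ¬? (x ≟ n))

without-below : ∀ n B → All (_< n) B → without n B ≡ B
without-below n B B<n = filter-all (λ x → ¬? (x ≟ n)) (All.map <⇒≢ B<n)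

without-snoc : ∀ n B → All (_< n) B → without n (B ++ n ∷ []) ≡ B
without-snoc n B B<n = begin
  without n (B ++ n ∷ [])            ≡⟨ filter-++ (λ x → ¬? (x ≟ n)) B (n ∷ []) ⟩
  without n B ++ without n (n ∷ [])  ≡⟨ cong₂ _++_ (without-below n B B<n)
                                               (filter-reject (λ x → ¬? (x ≟ n)) (λ n≢n → n≢n refl)) ⟩
  B ++ []                            ≡⟨ ++-identityʳ B ⟩
  B                                  ∎
  where open ≡-Reasoning

consNonempty : List ℕ → List (List ℕ) → List (List ℕ)
consNonempty [] Q = Q
consNonempty (y ∷ ys) Q = (y ∷ ys) ∷ Q

deleteMax : ℕ → List (List ℕ) → List (List ℕ)
deleteMax n [] = []
deleteMax n (B ∷ P) = consNonempty (without n B) (deleteMax n P)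

deleteMax-below : ∀ n P → All (BlockBelow n) P → deleteMax n P ≡ P
deleteMax-below n [] [] = refl
deleteMax-below n ((b ∷ B) ∷ P) ((_ , B<n) ∷ P<n)
  rewrite without-below n (b ∷ B) B<n | deleteMax-below n P P<n = refl

deleteMax-insertMax : ∀ n P → All (BlockBelow n) P → All (λ X → deleteMax n X ≡ P) (insertMax n P)
deleteMax-insertMax n [] [] = delete-singleton ∷ []
  where
  delete-singleton : deleteMax n ((n ∷ []) ∷ []) ≡ []
  delete-singleton rewrite filter-reject (λ x → ¬? (x ≟ n)) {n} {[]} (λ n≢n → n≢n refl) = refl
deleteMax-insertMax n ((b ∷ B) ∷ P) ((_ , B<n) ∷ P<n) =
  delete-appended
  ∷ map⁺ (All.map (λ {X} X↦P → trans (cong (λ C → consNonempty C (deleteMax n X))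
                                            (without-below n (b ∷ B) B<n))
                                      (cong ((b ∷ B) ∷_) X↦P))
                  (deleteMax-insertMax n P P<n))
  where
  delete-appended : deleteMax n (((b ∷ B) ++ n ∷ []) ∷ P) ≡ (b ∷ B) ∷ P
  delete-appended rewrite without-snoc n (b ∷ B) B<n | deleteMax-below n P P<n = refl

insertMax-unique : ∀ n P → Unique (insertMax n P)
insertMax-unique n [] = [] ∷ []
insertMax-unique n (B ∷ P) =
  map⁺ (All.universal (λ X e → snoc≢ B (∷-injectiveˡ e)) (insertMax n P))
  ∷ Unique.map⁺ ∷-injectiveʳ (insertMax-unique n P)
  where
  snoc≢ : ∀ B → B ++ n ∷ [] ≢ B
  snoc≢ [] ()
  snoc≢ (x ∷ B) e = snoc≢ B (∷-injectiveʳ e)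

Unique-concatMap⁺ : {X Y : Set} (f : X → List Y) (g : Y → X) {xs : List X} → Unique xs →
  All (λ x → Unique (f x) × All (λ y → g y ≡ x) (f x)) xs → Unique (concatMap f xs)
Unique-concatMap⁺ f g [] _ = []
Unique-concatMap⁺ f g {x ∷ xs} (x∉xs ∷ xs!) ((fx! , g∘fx) ∷ rest) =
  Unique.++⁺ fx! (Unique-concatMap⁺ f g xs! rest) disjoint
  where
  disjoint : ∀ {y} → ¬ (y ∈ f x × y ∈ concatMap f xs)
  disjoint (y∈fx , y∈rest) with ∈-concatMap-elim y∈rest
  ... | x′ , x′∈xs , y∈fx′ =
    All.lookup x∉xs x′∈xs (trans (sym (All.lookup g∘fx y∈fx))
                                 (All.lookup (proj₂ (All.lookup rest x′∈xs)) y∈fx′))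

partitions-unique : ∀ n → Unique (partitions n)
partitions-unique zero = [] ∷ []
partitions-unique (suc m) =
  Unique-concatMap⁺ (insertMax (suc m)) (deleteMax (suc m)) (partitions-unique m)
    (All.map (λ {P} P<1+m → insertMax-unique (suc m) P , deleteMax-insertMax (suc m) P P<1+m) (partitions-below m))

++≡++∷-cases : ∀ (B r a b : List ℕ) n → B ++ r ≡ a ++ n ∷ b →
  (∃ λ B′ → B ≡ a ++ n ∷ B′ × b ≡ B′ ++ r) ⊎ (∃ λ a′ → a ≡ B ++ a′ × r ≡ a′ ++ n ∷ b)
++≡++∷-cases [] r a b n e = inj₂ (a , refl , e)
++≡++∷-cases (x ∷ B) r [] b n e = inj₁ (B , cong (_∷ B) (∷-injectiveˡ e) , sym (∷-injectiveʳ e))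
++≡++∷-cases (x ∷ B) r (y ∷ a) b n e with ++≡++∷-cases B r a b n (∷-injectiveʳ e)
... | inj₁ (B′ , B≡ , b≡) = inj₁ (B′ , cong₂ _∷_ (∷-injectiveˡ e) B≡ , b≡)
... | inj₂ (a′ , a≡ , r≡) = inj₂ (a′ , cong₂ _∷_ (sym (∷-injectiveˡ e)) a≡ , r≡)

Increasing-∷⁻ : ∀ x xs → Increasing (x ∷ xs) → Increasing xs
Increasing-∷⁻ x [] _ = tt
Increasing-∷⁻ x (y ∷ r) (_ , r↑) = r↑

Increasing-middle : ∀ a n c r → Increasing (a ++ n ∷ c ∷ r) → n < c
Increasing-middle [] n c r (n<c , _) = n<c
Increasing-middle (x ∷ a) n c r xs↑ = Increasing-middle a n c r (Increasing-∷⁻ x (a ++ n ∷ c ∷ r) xs↑)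

Increasing-++⁻ˡ : ∀ xs ys → Increasing (xs ++ ys) → Increasing xs
Increasing-++⁻ˡ [] ys _ = tt
Increasing-++⁻ˡ (x ∷ []) ys _ = tt
Increasing-++⁻ˡ (x ∷ y ∷ r) ys (x<y , r↑) = x<y , Increasing-++⁻ˡ (y ∷ r) ys r↑

HeadBelow-sameHead : ∀ x r r′ P → HeadBelow (x ∷ r) P → HeadBelow (x ∷ r′) P
HeadBelow-sameHead x r r′ [] _ = tt
HeadBelow-sameHead x r r′ (C ∷ P) x≤C = x≤C

HeadBelow-insertMax⁻ : ∀ n B Q {P} → IncreasingBlocks Q → P ∈ insertMax n Q → HeadBelow B P → HeadBelow B Q
HeadBelow-insertMax⁻ n B [] _ _ _ = tt
HeadBelow-insertMax⁻ n B ([] ∷ Q) ((() , _) ∷ _) _ _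
HeadBelow-insertMax⁻ n B ((c ∷ C) ∷ Q) _ (here refl) B≤c = B≤c
HeadBelow-insertMax⁻ n B ((c ∷ C) ∷ Q) _ (there P∈) B≤P with ∈-map⁻ ((c ∷ C) ∷_) P∈
... | _ , _ , refl = B≤P

-- n exceeds every other entry, so it ends its increasing block; if that block is {n} it is the
-- last one, since blocks are sorted by their heads.
insertMax-preimage : ∀ n P a b → IncreasingBlocks P → HeadsSorted P → concat P ≡ a ++ n ∷ b →
  All (_< n) a → All (_< n) b →
  ∃ λ Q → IncreasingBlocks Q × HeadsSorted Q × concat Q ≡ a ++ b × P ∈ insertMax n Q
insertMax-preimage n [] [] b _ _ () _ _
insertMax-preimage n [] (x ∷ a) b _ _ () _ _
insertMax-preimage n (B ∷ P) a b ((B≢[] , B↑) ∷ P↑) (B≤P , P-sorted) e a<n b<n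
  with ++≡++∷-cases B (concat P) a b n e
... | inj₁ (c ∷ r , refl , b≡) =
  ⊥-elim (<-asym (Increasing-middle a n c r B↑) (All.lookup b<n (subst (c ∈_) (sym b≡) (here refl))))
... | inj₁ ([] , refl , b≡) = block-ends-with-n a P a<n b≡ B↑ P↑ B≤P P-sorted
  where
  block-ends-with-n : ∀ a P → All (_< n) a → b ≡ concat P → Increasing (a ++ n ∷ []) → IncreasingBlocks P →
    HeadBelow (a ++ n ∷ []) P → HeadsSorted P →
    ∃ λ Q → IncreasingBlocks Q × HeadsSorted Q × concat Q ≡ a ++ b × (a ++ n ∷ []) ∷ P ∈ insertMax n Q
  block-ends-with-n [] [] _ b≡ _ _ _ _ = [] , [] , tt , sym b≡ , here refl
  block-ends-with-n [] (C ∷ P) _ b≡ _ ((C≢[] , _) ∷ _) n≤C _ =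
    ⊥-elim (<⇒≱ (All.lookup b<n (subst (headOr0 C ∈_) (sym b≡) (∈-++⁺ˡ (headOr0-∈ C C≢[])))) n≤C)
  block-ends-with-n (x ∷ a) P _ b≡ xa↑ P↑ xa≤P P-sorted =
    (x ∷ a) ∷ P , (tt , Increasing-++⁻ˡ (x ∷ a) (n ∷ []) xa↑) ∷ P↑ ,
    (HeadBelow-sameHead x _ a P xa≤P , P-sorted) , cong ((x ∷ a) ++_) (sym b≡) , here refl
... | inj₂ (a′ , refl , P≡) with insertMax-preimage n P a′ b P↑ P-sorted P≡ (++⁻ʳ B a<n) b<n
...   | Q , Q↑ , Q-sorted , Q≡ , P∈ =
  B ∷ Q , (B≢[] , B↑) ∷ Q↑ , (HeadBelow-insertMax⁻ n B Q Q↑ P∈ B≤P , Q-sorted) ,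
  trans (cong (B ++_) Q≡) (sym (++-assoc B a′ b)) , there (∈-map⁺ (B ∷_) P∈)

partitions-complete : ∀ n P → IncreasingBlocks P → HeadsSorted P → concat P ∈ perms n → P ∈ partitions n
partitions-complete zero [] _ _ _ = here refl
partitions-complete zero ([] ∷ P) ((() , _) ∷ _) _ _
partitions-complete zero ((b ∷ B) ∷ P) _ _ (here ())
partitions-complete zero ((b ∷ B) ∷ P) _ _ (there ())
partitions-complete (suc m) P P↑ P-sorted P∈ with ∈-concatMap-elim P∈
... | τ , τ∈ , P∈′ with ∈-insertAll⁻ (suc m) τ P∈′
...   | a , b , refl , P≡ with ++⁻ a (All.lookup (perms-below m) τ∈)
...     | a<1+m , b<1+m with insertMax-preimage (suc m) P a b P↑ P-sorted P≡ a<1+m b<1+m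
...       | Q , Q↑ , Q-sorted , Q≡ , P∈Q =
  ∈-concatMap-intro (partitions-complete m Q Q↑ Q-sorted (subst (_∈ perms m) (sym Q≡) τ∈)) P∈Q

-- RSP(n) as the words of ascent-free partitions

Unique-↭ : ∀ {xs ys : List ℕ} → xs ↭ ys → Unique xs → Unique ys
Unique-↭ xs↭ys = PermutationSetoid.Unique-resp-↭ (↭⇒↭ₛ xs↭ys)

concat-↭ : ∀ {xss yss : List (List ℕ)} → xss ↭ yss → concat xss ↭ concat yss
concat-↭ ↭.refl = ↭-refl
concat-↭ (prep xs p) = ++⁺ˡ xs (concat-↭ p)
concat-↭ (swap xs ys p) = ↭-trans (shifts xs ys) (++⁺ˡ ys (++⁺ˡ xs (concat-↭ p)))
concat-↭ (↭.trans p q) = ↭-trans (concat-↭ p) (concat-↭ q)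

Unique-map⁺ : {X Y : Set} (f : X → Y) {xs : List X} → Unique xs →
  (∀ {x y} → x ∈ xs → y ∈ xs → f x ≡ f y → x ≡ y) → Unique (map f xs)
Unique-map⁺ f [] _ = []
Unique-map⁺ f (x∉xs ∷ xs!) f-injective =
  map⁺ (All.tabulate (λ y∈xs fx≡fy → All.lookup x∉xs y∈xs (f-injective (here refl) (there y∈xs) fx≡fy)))
  ∷ Unique-map⁺ f xs! (λ x∈ y∈ → f-injective (there x∈) (there y∈))

noAscents? : (P : List (List ℕ)) → Dec (ascents P ≡ 0)
noAscents? P = ascents P ≟ 0

ascentFreeWords : ℕ → List (List ℕ)
ascentFreeWords n = map concat (filter noAscents? (partitions n))

ascentFreeWords-unique : ∀ n → Unique (ascentFreeWords n)
ascentFreeWords-unique n = Unique-map⁺ concat (Unique.filter⁺ noAscents? (partitions-unique n)) concat-injective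
  where
  runs-concat-id : ∀ {P} → P ∈ filter noAscents? (partitions n) → runs (concat P) ≡ P
  runs-concat-id P∈ with ∈-filter⁻ noAscents? P∈
  ... | P∈′ , no-ascents = runs-concat _ (proj₁ (All.lookup (partitions-sorted n) P∈′)) no-ascents
  concat-injective : ∀ {P Q} → P ∈ filter noAscents? (partitions n) → Q ∈ filter noAscents? (partitions n) →
                     concat P ≡ concat Q → P ≡ Q
  concat-injective P∈ Q∈ e = trans (sym (runs-concat-id P∈)) (trans (cong runs e) (runs-concat-id Q∈))

runsort-∈-ascentFreeWords : ∀ n {σ} → σ ∈ perms n → runsort σ ∈ ascentFreeWords n
runsort-∈-ascentFreeWords n {σ} σ∈ =
  ∈-map∘filter⁺ concat noAscents? (T , T∈ , sym sameWord , noAscents)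
  where
  S : List (List ℕ)
  S = sortRuns (runs σ)
  S↑ : IncreasingBlocks S
  S↑ = All-resp-↭ (↭-sym (sortRuns-↭ (runs σ))) (runs-increasing σ)
  S↭σ : concat S ↭ σ
  S↭σ = ↭-trans (concat-↭ (sortRuns-↭ (runs σ))) (↭-reflexive (concat-runs σ))
  T : List (List ℕ)
  T = joinAscents S
  open Regrouping (joinAscents-regrouping S S↑ (sortRuns-sorted (runs σ))
                                           (Unique-↭ (↭-sym S↭σ) (All.lookup (perms-unique n) σ∈)))
  T∈ : T ∈ partitions n
  T∈ = partitions-complete n T increasing sorted (perms-↭-closed n (subst (_↭ σ) (sym sameWord) S↭σ) σ∈)

ascentFreeWords-⊆-RSP : ∀ n {w} → w ∈ ascentFreeWords n → w ∈ RSP n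
ascentFreeWords-⊆-RSP n w∈ with ∈-map∘filter⁻ concat noAscents? w∈
... | P , P∈ , refl , no-ascents =
  Equivalence.to (deduplicate-∈⇔ (≡-dec _≟_))
    (subst (_∈ map runsort (perms n)) runsort-id (∈-map⁺ runsort (concat-partitions n P∈)))
  where
  runsort-id : runsort (concat P) ≡ concat P
  runsort-id rewrite runs-concat P (proj₁ (All.lookup (partitions-sorted n) P∈)) no-ascents
                   | sortRuns-sorted-id P (proj₂ (All.lookup (partitions-sorted n) P∈)) = refl

RSP↭ascentFreeWords : ∀ n → RSP n ↭ ascentFreeWords n
RSP↭ascentFreeWords n =
  ∼bag⇒↭ (unique∧set⇒bag (deduplicate-! (map runsort (perms n))) (ascentFreeWords-unique n)
                          (mk⇔ RSP⊆ (ascentFreeWords-⊆-RSP n)))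
  where
  RSP⊆ : ∀ {w} → w ∈ RSP n → w ∈ ascentFreeWords n
  RSP⊆ w∈ with ∈-map⁻ runsort (Equivalence.from (deduplicate-∈⇔ (≡-dec _≟_)) w∈)
  ... | σ , σ∈ , refl = runsort-∈-ascentFreeWords n σ∈

∑-filter≟ : {X : Set} (g f : X → ℕ) (k : ℕ) (xs : List X) →
            ∑ g (filter (λ x → f x ≟ k) xs) ≡ ∑ (λ x → g x * δ (f x) k) xs
∑-filter≟ g f k [] = refl
∑-filter≟ g f k (x ∷ xs) with f x ≟ k
... | yes fx≡k = trans (cong (∑ g) (filter-accept (λ y → f y ≟ k) fx≡k))
                       (cong₂ _+_ (sym g*δ≡g) (∑-filter≟ g f k xs))
  where
  g*δ≡g : g x * δ (f x) k ≡ g x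
  g*δ≡g rewrite fx≡k | δ-refl k = *-identityʳ (g x)
... | no fx≢k = trans (cong (∑ g) (filter-reject (λ y → f y ≟ k) fx≢k))
                      (trans (∑-filter≟ g f k xs) (cong (_+ ∑ (λ x → g x * δ (f x) k) xs) (sym g*δ≡0)))
  where
  g*δ≡0 : g x * δ (f x) k ≡ 0
  g*δ≡0 rewrite δ-≢ fx≢k = *-zeroʳ (g x)

length≡∑1 : {X : Set} (xs : List X) → length xs ≡ ∑ (λ _ → 1) xs
length≡∑1 [] = refl
length≡∑1 (x ∷ xs) = cong suc (length≡∑1 xs)

length-filter≟ : {X : Set} (f : X → ℕ) (k : ℕ) (xs : List X) →
                 length (filter (λ x → f x ≟ k) xs) ≡ ∑ (λ x → δ (f x) k) xs
length-filter≟ f k xs = begin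
  length (filter (λ x → f x ≟ k) xs)   ≡⟨ length≡∑1 (filter (λ x → f x ≟ k) xs) ⟩
  ∑ (λ _ → 1) (filter (λ x → f x ≟ k) xs)  ≡⟨ ∑-filter≟ (λ _ → 1) f k xs ⟩
  ∑ (λ x → 1 * δ (f x) k) xs          ≡⟨ ∑-cong (All.universal (λ x → *-identityˡ (δ (f x) k)) xs) ⟩
  ∑ (λ x → δ (f x) k) xs              ∎
  where open ≡-Reasoning

χ-concat : ∀ k P → Nonempty P → IncreasingBlocks P → δ (suc (des (concat P))) k * δ (ascents P) 0 ≡ χ k 0 P
χ-concat k (B ∷ P) _ P↑ with ascents (B ∷ P) ≟ 0
... | yes no-ascents = cong (λ L → δ L k * δ (ascents (B ∷ P)) 0) (des-concat B P P↑ no-ascents)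
... | no ascents≢0 rewrite δ-≢ ascents≢0 | *-zeroʳ (δ (suc (des (concat (B ∷ P)))) k)
                         | *-zeroʳ (δ (length (B ∷ P)) k) = refl

R≡count : ∀ m k → R (suc m) k ≡ count (suc m) k 0
R≡count m k = begin
  R (suc m) k
    ≡⟨ ↭-length (filter-↭ (λ π → suc (des π) ≟ k) (RSP↭ascentFreeWords (suc m))) ⟩
  length (filter (λ π → suc (des π) ≟ k) (ascentFreeWords (suc m)))
    ≡⟨ length-filter≟ (suc ∘ des) k (ascentFreeWords (suc m)) ⟩
  ∑ (λ π → δ (suc (des π)) k) (ascentFreeWords (suc m))
    ≡⟨ ∑-map (λ π → δ (suc (des π)) k) concat (filter noAscents? Ps) ⟩
  ∑ (λ P → δ (suc (des (concat P))) k) (filter noAscents? Ps)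
    ≡⟨ ∑-filter≟ (λ P → δ (suc (des (concat P))) k) ascents 0 Ps ⟩
  ∑ (λ P → δ (suc (des (concat P))) k * δ (ascents P) 0) Ps
    ≡⟨ ∑-cong (All.zipWith (λ {P} (P≢[] , P↑ , _) → χ-concat k P P≢[] P↑)
                           (partitions-nonempty m , partitions-sorted (suc m))) ⟩
  count (suc m) k 0 ∎
  where
  open ≡-Reasoning
  Ps : List (List (List ℕ))
  Ps = partitions (suc m)

lemma3p4 : (R 1 ≐ tPoly) × (R 2 ≐ tPoly)
    × (∀ (n : ℕ) → 3 ≤ n → R n ≐ (mulT (deriv (R (n ∸ 1))) ⊕ mulT (scale (n ∸ 2) (R (n ∸ 2)))))
lemma3p4 = R₁ , R₂ , R-rec
  where
  R₁ : R 1 ≐ tPoly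
  R₁ zero = refl
  R₁ (suc zero) = refl
  R₁ (suc (suc k)) = refl
  R₂ : R 2 ≐ tPoly
  R₂ zero = refl
  R₂ (suc zero) = refl
  R₂ (suc (suc k)) = refl
  R-rec : ∀ (n : ℕ) → 3 ≤ n → R n ≐ (mulT (deriv (R (n ∸ 1))) ⊕ mulT (scale (n ∸ 2) (R (n ∸ 2))))
  R-rec (suc (suc (suc m))) (s≤s (s≤s (s≤s _))) zero = trans (R≡count (2 + m) 0) (count-no-blocks (2 + m) 0)
  R-rec (suc (suc (suc m))) (s≤s (s≤s (s≤s _))) (suc j) = begin
    R (3 + m) (suc j)                                                    ≡⟨ R≡count (2 + m) (suc j) ⟩
    count (3 + m) (suc j) 0                                              ≡⟨ count-rec (suc m) (suc j) 0 ⟩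
    suc j * count (2 + m) (suc j) 0 + 1 * count (2 + m) (suc j) 1 + 0   ≡⟨ +-identityʳ _ ⟩
    suc j * count (2 + m) (suc j) 0 + 1 * count (2 + m) (suc j) 1
      ≡⟨ cong₂ (λ u v → suc j * u + v) (sym (R≡count (suc m) (suc j))) (count-ascent-shift (suc m) j 0) ⟩
    suc j * R (2 + m) (suc j) + suc m * count (suc m) j 0
      ≡⟨ cong (λ u → suc j * R (2 + m) (suc j) + suc m * u) (sym (R≡count m j)) ⟩
    suc j * R (2 + m) (suc j) + suc m * R (suc m) j                      ∎
    where open ≡-Reasoning
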